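{- Let $l\ge1$, $n=l+4$, and let $w=(c_1,\dots,c_{l+1})$ be a worm. Let $c_i$ be a cell at which a worm operation can be applied (a bend, $c_1$, or $c_{l+1}$), and let $w'$ be the worm obtained by applying the worm operation at $c_i$, replacing $c_i$ by a cell $\tilde c_i$. Then the triangulation $\Delta(w')$ is obtained from $\Delta(w)$ by flipping the diagonal corresponding to $c_i$; that is, the diagonal corresponding to $\tilde c_i$ is the other diagonal of the quadrilateral formed by the two triangles of $\Delta(w)$ adjacent to the diagonal corresponding to $c_i$, and $\Delta(w')=(\Delta(w)\setminus\{\text{diagonal of }c_i\})\cup\{\text{diagonal of }\tilde c_i\}$.
   Context: Let $\mathcal P=P_1P_2\cdots P_n$ be a convex $n$-gon, indices taken modulo $n$. The staircase is the set of cells $(q,r)\in(\mathbb Z/n\mathbb Z)^2$ ($q$ = column, $r$ = row) with $q-r\notin\{ -1,0,1\}$; the cell $(q,r)$ corresponds to the diagonal $P_qP_r$. A worm is a sequence $c_1,\dots,c_{l+1}$ of cells with $c_1=(q_1,r_1)$, $q_1-r_1=2$, and $c_{k+1}-c_k\in\{(1,0),(0,-1)\}$ for each $k$ (an "east step" $(1,0)$ or a "north step" $(0,-1)$). For a worm $w$, $\Delta(w)$ denotes the set of diagonals corresponding to its cells; it is taken as known that $\Delta(w)$ is a triangulation of $\mathcal P$. A cell $c_i$ with $1<i<l+1$ is a bend if the steps $c_{i-1}\to c_i$ and $c_i\to c_{i+1}$ differ; it is an NE-bend if the first is north and the second east, an EN-bend otherwise. Worm operation at $c_i$: at an NE-bend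 replace $c_i$ by $c_i+(1,1)$; at an EN-bend by $c_i-(1,1)$; at $c_1$ replace $c_1$ by $c_1+(1,1)$ if $c_1\to c_2$ is east and by $c_1-(1,1)$ if it is north; at $c_{l+1}$ replace $c_{l+1}$ by $c_{l+1}+(1,1)$ if $c_l\to c_{l+1}$ is north and by $c_{l+1}-(1,1)$ if it is east. -}

module Defs where

open import Data.Nat using (ℕ; zero; suc; _+_; _∸_; _<_; _≤_; NonZero)
open import Data.Nat.DivMod using (_%_; m%n<n)
open import Data.Fin using (Fin; toℕ; fromℕ<)
open import Data.Product using (Σ; ∃; ∃-syntax; _×_; _,_; proj₁; proj₂)
open import Data.Sum using (_⊎_)
open import Relation.Binary.PropositionalEquality using (_≡_; _≢_)
open import Relation.Nullary using (¬_)

-- Vertices of the convex n-gon are Z/nZ, represented by Fin n.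
-- Throughout, n = 4 + l (written so that n is syntactically a suc).

Vtx : ℕ → Set
Vtx l = Fin (4 + l)

mod : (l : ℕ) → ℕ → Vtx l
mod l m = fromℕ< (m%n<n m (4 + l))

inc : {l : ℕ} → Vtx l → Vtx l
inc {l} q = mod l (suc (toℕ q))

dec : {l : ℕ} → Vtx l → Vtx l
dec {l} q = mod l (toℕ q + (3 + l))

sub : {l : ℕ} → Vtx l → Vtx l → ℕ
sub {l} q r = (toℕ q + ((4 + l) ∸ toℕ r)) % (4 + l)

-- Cells (q , r) : q = column, r = row.  Cell (q,r) ↔ diagonal P_q P_r.

Cell : ℕ → Set
Cell l = Vtx l × Vtx l

-- staircase membership: q - r ∉ {-1, 0, 1}  (mod n)
InStaircase : {l : ℕ} → Cell l → Set
InStaircase {l} (q , r) = ¬ (sub q r ≡ 0) × ¬ (sub q r ≡ 1) × ¬ (sub q r ≡ 3 + l)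

East : {l : ℕ} → Cell l → Cell l → Set
East (q , r) (q' , r') = (q' ≡ inc q) × (r' ≡ r)

North : {l : ℕ} → Cell l → Cell l → Set
North (q , r) (q' , r') = (q' ≡ q) × (r' ≡ dec r)

plus11 : {l : ℕ} → Cell l → Cell l
plus11 (q , r) = (inc q , inc r)

minus11 : {l : ℕ} → Cell l → Cell l
minus11 (q , r) = (dec q , dec r)

-- Worms of length l+1 (cells c_1 … c_{l+1}, indexed 0 … l by Fin (suc l)).

record Worm (l : ℕ) : Set where
  field
    cell      : Fin (suc l) → Cell l
    stair     : (k : Fin (suc l)) → InStaircase (cell k)
    start     : (k : Fin (suc l)) → toℕ k ≡ 0 →
                sub (proj₁ (cell k)) (proj₂ (cell k)) ≡ 2
    step      : (j k : Fin (suc l)) → suc (toℕ j) ≡ toℕ k →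
                East (cell j) (cell k) ⊎ North (cell j) (cell k)
open Worm public

data OpAt {l : ℕ} (w : Worm l) (i : Fin (suc l)) : Cell l → Set where
  neBend : (p s : Fin (suc l)) → suc (toℕ p) ≡ toℕ i → suc (toℕ i) ≡ toℕ s →
           North (cell w p) (cell w i) → East (cell w i) (cell w s) →
           OpAt w i (plus11 (cell w i))
  enBend : (p s : Fin (suc l)) → suc (toℕ p) ≡ toℕ i → suc (toℕ i) ≡ toℕ s →
           East (cell w p) (cell w i) → North (cell w i) (cell w s) →
           OpAt w i (minus11 (cell w i))
  firstE : (s : Fin (suc l)) → toℕ i ≡ 0 → suc (toℕ i) ≡ toℕ s →
           East (cell w i) (cell w s) → OpAt w i (plus11 (cell w i))
  firstN : (s : Fin (suc l)) → toℕ i ≡ 0 → suc (toℕ i) ≡ toℕ s →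
           North (cell w i) (cell w s) → OpAt w i (minus11 (cell w i))
  lastN  : (p : Fin (suc l)) → toℕ i ≡ l → suc (toℕ p) ≡ toℕ i →
           North (cell w p) (cell w i) → OpAt w i (plus11 (cell w i))
  lastE  : (p : Fin (suc l)) → toℕ i ≡ l → suc (toℕ p) ≡ toℕ i →
           East (cell w p) (cell w i) → OpAt w i (minus11 (cell w i))

replace : {l : ℕ} → (Fin (suc l) → Cell l) → Fin (suc l) → Cell l →
          Fin (suc l) → Cell l
replace c i c̃ j with Data.Fin._≟_ j i
... | Relation.Nullary.yes _ = c̃
... | Relation.Nullary.no  _ = c j

SameDiag : {l : ℕ} → Vtx l → Vtx l → Vtx l → Vtx l → Set
SameDiag a b a' b' = (a ≡ a' × b ≡ b') ⊎ (a ≡ b' × b ≡ a')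

InΔ : {l : ℕ} → (Fin (suc l) → Cell l) → Vtx l → Vtx l → Set
InΔ c a b = ∃[ k ] SameDiag (proj₁ (c k)) (proj₂ (c k)) a b

Side : {l : ℕ} → Vtx l → Vtx l → Set
Side a b = (b ≡ inc a) ⊎ (a ≡ inc b)

EdgeOf : {l : ℕ} → (Fin (suc l) → Cell l) → Vtx l → Vtx l → Set
EdgeOf c a b = Side a b ⊎ InΔ c a b

StrictlyBetween : {l : ℕ} → Vtx l → Vtx l → Vtx l → Set
StrictlyBetween a x b = (0 < sub x a) × (sub x a < sub b a)

IsFlip : {l : ℕ} → (Fin (suc l) → Cell l) → (Fin (suc l) → Cell l) →
         Vtx l → Vtx l → Vtx l → Vtx l → Set
IsFlip c c' a b a' b' =
  (∃[ x ] ∃[ y ]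
     StrictlyBetween a x b × StrictlyBetween b y a ×
     EdgeOf c a x × EdgeOf c x b × EdgeOf c a y × EdgeOf c y b ×
     SameDiag a' b' x y)
  ×
  ((u v : Vtx _) →
     (InΔ c' u v → (InΔ c u v × ¬ SameDiag u v a b) ⊎ SameDiag u v a' b') ×
     ((InΔ c u v × ¬ SameDiag u v a b) ⊎ SameDiag u v a' b' → InΔ c' u v))

module Submission where

open import Defs
open import Data.Nat using (ℕ; zero; suc; _+_; _∸_; _<_; _≤_; z≤n; s≤s; NonZero)
open import Data.Nat.Properties hiding (_≟_)
open import Data.Nat.DivMod using (_%_; m%n<n; %-distribˡ-+; m%n%n≡m%n; [m+n]%n≡m%n; m<n⇒m%n≡m)
open import Data.Fin using (Fin; toℕ; inject₁; _≟_) renaming (zero to fzero; suc to fsuc)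
open import Data.Fin.Properties using (toℕ-fromℕ<; toℕ-injective; toℕ<n; toℕ≤pred[n]; toℕ-inject₁)
open import Data.Fin.Induction using (<-weakInduction)
open import Data.Product using (∃-syntax; _×_; _,_; proj₁; proj₂)
open import Data.Sum using (_⊎_; inj₁; inj₂; [_,_]′)
open import Data.Empty using (⊥; ⊥-elim)
open import Function using (_∘_)
open import Relation.Nullary using (¬_; yes; no)
open import Relation.Binary.PropositionalEquality

-- Measured from the column o of c₁, the cell c_{k+1} is (o + e, o + ρ), where e ≤ k counts the east
-- steps so far and e + l + 2 = k + ρ. So its diagonal has width q − r = k + 2, and ρ ≥ e + 2 keeps a
-- cell from being the reverse of another: distinct cells give distinct diagonals, and replacing c_i
-- removes exactly the diagonal of c_i from Δ(w).
-- If c̃ = c_i + (1,1), the quadrilateral around P_q P_r is P_q P_{q+1} P_r P_{r+1}: two of its edges are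
-- polygon sides, the other two are the diagonals of the neighbours c_{i+1} = (q+1, r) and
-- c_{i-1} = (q, r+1) (polygon sides at the ends of the worm), and its other diagonal is P_{q+1} P_{r+1}.
-- The case c̃ = c_i − (1,1) is symmetric, with the quadrilateral P_q P_{r-1} P_r P_{q-1}.

[m%d+n]%d≡[m+n]%d : ∀ m n d .{{_ : NonZero d}} → (m % d + n) % d ≡ (m + n) % d
[m%d+n]%d≡[m+n]%d m n d = begin
  (m % d + n) % d          ≡⟨ %-distribˡ-+ (m % d) n d ⟩
  (m % d % d + n % d) % d  ≡⟨ cong (λ x → (x + n % d) % d) (m%n%n≡m%n m d) ⟩
  (m % d + n % d) % d      ≡⟨ %-distribˡ-+ m n d ⟨
  (m + n) % d              ∎
  where open ≡-Reasoning

module _ {l : ℕ} where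

  shift : Vtx l → ℕ → Vtx l
  shift a s = mod l (toℕ a + s)

  toℕ-shift : ∀ a s → toℕ (shift a s) ≡ (toℕ a + s) % (4 + l)
  toℕ-shift a s = toℕ-fromℕ< (m%n<n (toℕ a + s) (4 + l))

  shift-+ : ∀ a s t → shift (shift a s) t ≡ shift a (s + t)
  shift-+ a s t = toℕ-injective (begin
    toℕ (shift (shift a s) t)              ≡⟨ toℕ-shift (shift a s) t ⟩
    (toℕ (shift a s) + t) % (4 + l)        ≡⟨ cong (λ x → (x + t) % (4 + l)) (toℕ-shift a s) ⟩
    ((toℕ a + s) % (4 + l) + t) % (4 + l)  ≡⟨ [m%d+n]%d≡[m+n]%d (toℕ a + s) t (4 + l) ⟩
    (toℕ a + s + t) % (4 + l)              ≡⟨ cong (_% (4 + l)) (+-assoc (toℕ a) s t) ⟩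
    (toℕ a + (s + t)) % (4 + l)            ≡⟨ toℕ-shift a (s + t) ⟨
    toℕ (shift a (s + t))                  ∎)
    where open ≡-Reasoning

  shift-zero : ∀ a → shift a 0 ≡ a
  shift-zero a = toℕ-injective (begin
    toℕ (shift a 0)        ≡⟨ toℕ-shift a 0 ⟩
    (toℕ a + 0) % (4 + l)  ≡⟨ cong (_% (4 + l)) (+-identityʳ (toℕ a)) ⟩
    toℕ a % (4 + l)        ≡⟨ m<n⇒m%n≡m (toℕ<n a) ⟩
    toℕ a                  ∎)
    where open ≡-Reasoning

  shift-period : ∀ a → shift a (4 + l) ≡ a
  shift-period a = toℕ-injective (begin
    toℕ (shift a (4 + l))          ≡⟨ toℕ-shift a (4 + l) ⟩
    (toℕ a + (4 + l)) % (4 + l)    ≡⟨ [m+n]%n≡m%n (toℕ a) (4 + l) ⟩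
    toℕ a % (4 + l)                ≡⟨ m<n⇒m%n≡m (toℕ<n a) ⟩
    toℕ a                          ∎)
    where open ≡-Reasoning

  shift-+-period : ∀ a s → shift a (s + (4 + l)) ≡ shift a s
  shift-+-period a s = trans (sym (shift-+ a s (4 + l))) (shift-period (shift a s))

  inc≡shift1 : ∀ a → inc a ≡ shift a 1
  inc≡shift1 a = cong (mod l) (+-comm 1 (toℕ a))

  inc-shift : ∀ a s → inc (shift a s) ≡ shift a (suc s)
  inc-shift a s = trans (inc≡shift1 (shift a s)) (trans (shift-+ a s 1) (cong (shift a) (+-comm s 1)))

  dec-shift : ∀ a s → dec (shift a (suc s)) ≡ shift a s
  dec-shift a s = trans (shift-+ a (suc s) (3 + l))
    (trans (cong (shift a) (sym (+-suc s (3 + l)))) (shift-+-period a s))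

  inc-dec : ∀ a → inc (dec a) ≡ a
  inc-dec a = trans (inc-shift a (3 + l)) (shift-period a)

  dec-inc : ∀ a → dec (inc a) ≡ a
  dec-inc a = trans (cong dec (inc≡shift1 a)) (trans (dec-shift a 0) (shift-zero a))

  sub<4+l : ∀ (x y : Vtx l) → sub x y < 4 + l
  sub<4+l x y = m%n<n (toℕ x + (4 + l ∸ toℕ y)) (4 + l)

  sub-shift : ∀ a {d} → d < 4 + l → sub (shift a d) a ≡ d
  sub-shift a {d} d<4+l = begin
    (toℕ (shift a d) + (4 + l ∸ toℕ a)) % (4 + l)          ≡⟨ cong (λ x → (x + (4 + l ∸ toℕ a)) % (4 + l)) (toℕ-shift a d) ⟩
    ((toℕ a + d) % (4 + l) + (4 + l ∸ toℕ a)) % (4 + l)    ≡⟨ [m%d+n]%d≡[m+n]%d (toℕ a + d) (4 + l ∸ toℕ a) (4 + l) ⟩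
    (toℕ a + d + (4 + l ∸ toℕ a)) % (4 + l)                ≡⟨ cong (λ x → (x + (4 + l ∸ toℕ a)) % (4 + l)) (+-comm (toℕ a) d) ⟩
    (d + toℕ a + (4 + l ∸ toℕ a)) % (4 + l)                ≡⟨ cong (_% (4 + l)) (+-assoc d (toℕ a) _) ⟩
    (d + (toℕ a + (4 + l ∸ toℕ a))) % (4 + l)              ≡⟨ cong (λ x → (d + x) % (4 + l)) (m+[n∸m]≡n (<⇒≤ (toℕ<n a))) ⟩
    (d + (4 + l)) % (4 + l)                                ≡⟨ [m+n]%n≡m%n d (4 + l) ⟩
    d % (4 + l)                                            ≡⟨ m<n⇒m%n≡m d<4+l ⟩
    d                                                      ∎
    where open ≡-Reasoning

  shift-sub : ∀ x y → shift y (sub x y) ≡ x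
  shift-sub x y = toℕ-injective (begin
    toℕ (shift y (sub x y))                        ≡⟨ toℕ-shift y (sub x y) ⟩
    (toℕ y + sub x y) % (4 + l)                    ≡⟨ cong (_% (4 + l)) (+-comm (toℕ y) (sub x y)) ⟩
    (sub x y + toℕ y) % (4 + l)                    ≡⟨ [m%d+n]%d≡[m+n]%d (toℕ x + (4 + l ∸ toℕ y)) (toℕ y) (4 + l) ⟩
    (toℕ x + (4 + l ∸ toℕ y) + toℕ y) % (4 + l)    ≡⟨ cong (_% (4 + l)) (+-assoc (toℕ x) _ (toℕ y)) ⟩
    (toℕ x + (4 + l ∸ toℕ y + toℕ y)) % (4 + l)    ≡⟨ cong (λ z → (toℕ x + z) % (4 + l)) (m∸n+n≡m (<⇒≤ (toℕ<n y))) ⟩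
    (toℕ x + (4 + l)) % (4 + l)                    ≡⟨ [m+n]%n≡m%n (toℕ x) (4 + l) ⟩
    toℕ x % (4 + l)                                ≡⟨ m<n⇒m%n≡m (toℕ<n x) ⟩
    toℕ x                                          ∎)
    where open ≡-Reasoning

  sub≡⇒≡shift : ∀ x y {d} → sub x y ≡ d → x ≡ shift y d
  sub≡⇒≡shift x y eq = trans (sym (shift-sub x y)) (cong (shift y) eq)

  shift-injective : ∀ a {s t} → s < 4 + l → t < 4 + l → shift a s ≡ shift a t → s ≡ t
  shift-injective a s<4+l t<4+l eq =
    trans (sym (sub-shift a s<4+l)) (trans (cong (λ x → sub x a) eq) (sub-shift a t<4+l))

  sub-inc : ∀ a → sub (inc a) a ≡ 1
  sub-inc a = trans (cong (λ x → sub x a) (inc≡shift1 a)) (sub-shift a (s≤s (s≤s z≤n)))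

  sub-dec : ∀ x y {d} → sub x y ≡ suc d → sub (dec x) y ≡ d
  sub-dec x y {d} eq = trans (cong (λ z → sub (dec z) y) (sub≡⇒≡shift x y eq))
    (trans (cong (λ z → sub z y) (dec-shift y d))
      (sub-shift y (<-trans (n<1+n d) (subst (_< 4 + l) eq (sub<4+l x y)))))

  sub-flip : ∀ x y {d e} → sub x y ≡ suc d → suc d + e ≡ 4 + l → sub y x ≡ e
  sub-flip x y {d} {e} eq sum = begin
    sub y x                          ≡⟨ cong (λ z → sub z x) y≡x+e ⟩
    sub (shift x e) x                ≡⟨ sub-shift x (subst (e <_) sum (m<n+m e (s≤s z≤n))) ⟩
    e                                ∎
    where
    open ≡-Reasoning
    y≡x+e : y ≡ shift x e
    y≡x+e = begin
      y                          ≡⟨ shift-period y ⟨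
      shift y (4 + l)            ≡⟨ cong (shift y) sum ⟨
      shift y (suc d + e)        ≡⟨ shift-+ y (suc d) e ⟨
      shift (shift y (suc d)) e  ≡⟨ cong (λ z → shift z e) (sub≡⇒≡shift x y eq) ⟨
      shift x e                  ∎

  sub≡2⇒≡inc-inc : ∀ x y → sub x y ≡ 2 → x ≡ inc (inc y)
  sub≡2⇒≡inc-inc x y eq =
    trans (sub≡⇒≡shift x y eq) (sym (trans (cong inc (inc≡shift1 y)) (inc-shift y 1)))

  inc-strictlyBetween : ∀ a b {d} → sub b a ≡ 2 + d → StrictlyBetween a (inc a) b
  inc-strictlyBetween a b eq =
    subst (0 <_) (sym (sub-inc a)) (s≤s z≤n) , subst₂ _<_ (sym (sub-inc a)) (sym eq) (s≤s (s≤s z≤n))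

  dec-strictlyBetween : ∀ a b {d} → sub b a ≡ 2 + d → StrictlyBetween a (dec b) b
  dec-strictlyBetween a b eq =
    subst (0 <_) (sym (sub-dec b a eq)) (s≤s z≤n) , subst₂ _<_ (sym (sub-dec b a eq)) (sym eq) ≤-refl

module _ {l : ℕ} (o : Vtx l) where

  record Offsets (k : ℕ) (c : Cell l) : Set where
    constructor offsets
    field
      col row : ℕ
      col≤k   : col ≤ k
      balance : col + (2 + l) ≡ k + row
      cell≡   : c ≡ (shift o col , shift o row)

  offsets-start : ∀ {r} → sub o r ≡ 2 → Offsets 0 (o , r)
  offsets-start {r} eq = offsets 0 (2 + l) z≤n refl
    (cong₂ _,_ (sym (shift-zero o)) (sub≡⇒≡shift r o (sub-flip o r eq refl)))

  offsets-east : ∀ {k c c'} → Offsets k c → East c c' → Offsets (suc k) c'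
  offsets-east (offsets col row col≤k balance cell≡) (q'≡ , r'≡) =
    offsets (suc col) row (s≤s col≤k) (cong suc balance)
      (cong₂ _,_ (trans q'≡ (trans (cong (inc ∘ proj₁) cell≡) (inc-shift o col)))
                 (trans r'≡ (cong proj₂ cell≡)))

  offsets-north : ∀ {k c c'} → suc k ≤ l → Offsets k c → North c c' → Offsets (suc k) c'
  offsets-north {k} k<l (offsets col zero _ balance _) _ = ⊥-elim (<⇒≱ k<l (begin
    l              ≤⟨ m≤n+m l 2 ⟩
    2 + l          ≤⟨ m≤n+m (2 + l) col ⟩
    col + (2 + l)  ≡⟨ balance ⟩
    k + 0          ≡⟨ +-identityʳ k ⟩
    k              ∎))
    where open ≤-Reasoning
  offsets-north {k} _ (offsets col (suc row) col≤k balance cell≡) (q'≡ , r'≡) =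
    offsets col row (m≤n⇒m≤1+n col≤k) (trans balance (+-suc k row))
      (cong₂ _,_ (trans q'≡ (cong proj₁ cell≡))
                 (trans r'≡ (trans (cong (dec ∘ proj₂) cell≡) (dec-shift o row))))

  open Offsets

  offsets-width : ∀ {k q r} → k ≤ l → Offsets k (q , r) → sub q r ≡ 2 + k
  offsets-width {k} {q} {r} k≤l (offsets col row _ balance cell≡) = begin
    sub q r                                          ≡⟨ cong₂ sub (cong proj₁ cell≡) (cong proj₂ cell≡) ⟩
    sub (shift o col) (shift o row)                  ≡⟨ cong (λ x → sub x (shift o row)) col≡row+2+k ⟩
    sub (shift (shift o row) (2 + k)) (shift o row)  ≡⟨ sub-shift (shift o row) (s≤s (s≤s (s≤s (m≤n⇒m≤1+n k≤l)))) ⟩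
    2 + k                                            ∎
    where
    open ≡-Reasoning
    col≡row+2+k : shift o col ≡ shift (shift o row) (2 + k)
    col≡row+2+k = begin
      shift o col                    ≡⟨ shift-+-period o col ⟨
      shift o (col + (4 + l))        ≡⟨ cong (shift o) (trans (+-suc col (3 + l)) (cong suc (+-suc col (2 + l)))) ⟩
      shift o (2 + (col + (2 + l)))  ≡⟨ cong (λ x → shift o (2 + x)) balance ⟩
      shift o (2 + k + row)          ≡⟨ cong (shift o) (+-comm (2 + k) row) ⟩
      shift o (row + (2 + k))        ≡⟨ shift-+ o row (2 + k) ⟨
      shift (shift o row) (2 + k)    ∎

  offsets-gap : ∀ {k c} → k ≤ l → (os : Offsets k c) → 2 + col os ≤ row os
  offsets-gap {k} k≤l (offsets col row _ balance _) = +-cancelʳ-≤ l (2 + col) row (begin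
    2 + col + l        ≡⟨ cong suc (+-suc col l) ⟨
    suc (col + suc l)  ≡⟨ +-suc col (suc l) ⟨
    col + (2 + l)      ≡⟨ balance ⟩
    k + row            ≤⟨ +-monoˡ-≤ row k≤l ⟩
    l + row            ≡⟨ +-comm l row ⟩
    row + l            ∎)
    where open ≤-Reasoning

  offsets-col< : ∀ {k c} → k ≤ l → (os : Offsets k c) → col os < 4 + l
  offsets-col< k≤l os = s≤s (≤-trans (col≤k os) (≤-trans k≤l (m≤n+m l 3)))

  offsets-row< : ∀ {k c} → (os : Offsets k c) → row os < 4 + l
  offsets-row< {k} (offsets col row col≤k balance _) =
    s≤s (≤-trans (+-cancelˡ-≤ k row (2 + l) (begin
      k + row       ≡⟨ balance ⟨
      col + (2 + l) ≤⟨ +-monoˡ-≤ (2 + l) col≤k ⟩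
      k + (2 + l)   ∎)) (n≤1+n (2 + l)))
    where open ≤-Reasoning

  offsets-unswapped : ∀ {j k a b a' b'} → j ≤ l → k ≤ l →
    Offsets j (a , b) → Offsets k (a' , b') → a ≡ b' → b ≡ a' → ⊥
  offsets-unswapped j≤l k≤l os os' a≡b' b≡a' = <-asym
    (subst (col os' <_) (sym colj≡rowk) (<⇒≤ (offsets-gap k≤l os')))
    (subst (col os <_) (sym colk≡rowj) (<⇒≤ (offsets-gap j≤l os)))
    where
    colj≡rowk : col os ≡ row os'
    colj≡rowk = shift-injective o (offsets-col< j≤l os) (offsets-row< os')
      (trans (sym (cong proj₁ (cell≡ os))) (trans a≡b' (cong proj₂ (cell≡ os'))))
    colk≡rowj : col os' ≡ row os
    colk≡rowj = shift-injective o (offsets-col< k≤l os') (offsets-row< os)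
      (trans (sym (cong proj₁ (cell≡ os'))) (trans (sym b≡a') (cong proj₂ (cell≡ os))))

module _ {l : ℕ} (w : Worm l) where

  origin : Vtx l
  origin = proj₁ (cell w fzero)

  worm-offsets : ∀ k → Offsets origin (toℕ k) (cell w k)
  worm-offsets = <-weakInduction (λ k → Offsets origin (toℕ k) (cell w k))
    (offsets-start origin (start w fzero refl)) next
    where
    next : ∀ j → Offsets origin (toℕ (inject₁ j)) (cell w (inject₁ j)) →
           Offsets origin (suc (toℕ j)) (cell w (fsuc j))
    next j os = [ offsets-east origin os′ , offsets-north origin (toℕ<n j) os′ ]′
      (step w (inject₁ j) (fsuc j) (cong suc (toℕ-inject₁ j)))
      where
      os′ : Offsets origin (toℕ j) (cell w (inject₁ j))
      os′ = subst (λ k → Offsets origin k (cell w (inject₁ j))) (toℕ-inject₁ j) os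

  worm-width : ∀ k → sub (proj₁ (cell w k)) (proj₂ (cell w k)) ≡ 2 + toℕ k
  worm-width k = offsets-width origin (toℕ≤pred[n] k) (worm-offsets k)

  worm-diagonal-injective : ∀ {j k} →
    SameDiag (proj₁ (cell w j)) (proj₂ (cell w j)) (proj₁ (cell w k)) (proj₂ (cell w k)) → j ≡ k
  worm-diagonal-injective {j} {k} (inj₁ (q≡ , r≡)) = toℕ-injective (+-cancelˡ-≡ 2 _ _
    (trans (sym (worm-width j)) (trans (cong₂ sub q≡ r≡) (worm-width k))))
  worm-diagonal-injective {j} {k} (inj₂ (q≡ , r≡)) = ⊥-elim (offsets-unswapped origin
    (toℕ≤pred[n] j) (toℕ≤pred[n] k) (worm-offsets j) (worm-offsets k) q≡ r≡)

module _ {l : ℕ} where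

  SameDiag-sym : ∀ {a b a' b' : Vtx l} → SameDiag a b a' b' → SameDiag a' b' a b
  SameDiag-sym (inj₁ (a≡ , b≡)) = inj₁ (sym a≡ , sym b≡)
  SameDiag-sym (inj₂ (a≡ , b≡)) = inj₂ (sym b≡ , sym a≡)

  SameDiag-trans : ∀ {a b a' b' a'' b'' : Vtx l} →
    SameDiag a b a' b' → SameDiag a' b' a'' b'' → SameDiag a b a'' b''
  SameDiag-trans (inj₁ (a≡ , b≡)) (inj₁ (a'≡ , b'≡)) = inj₁ (trans a≡ a'≡ , trans b≡ b'≡)
  SameDiag-trans (inj₁ (a≡ , b≡)) (inj₂ (a'≡ , b'≡)) = inj₂ (trans a≡ a'≡ , trans b≡ b'≡)
  SameDiag-trans (inj₂ (a≡ , b≡)) (inj₁ (a'≡ , b'≡)) = inj₂ (trans a≡ b'≡ , trans b≡ a'≡)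
  SameDiag-trans (inj₂ (a≡ , b≡)) (inj₂ (a'≡ , b'≡)) = inj₁ (trans a≡ b'≡ , trans b≡ a'≡)

  InFlippedΔ : (Fin (suc l) → Cell l) → Vtx l → Vtx l → Vtx l → Vtx l → Vtx l → Vtx l → Set
  InFlippedΔ c a b a' b' u v = (InΔ c u v × ¬ SameDiag u v a b) ⊎ SameDiag u v a' b'

  Exchanges : (Fin (suc l) → Cell l) → (Fin (suc l) → Cell l) → Vtx l → Vtx l → Vtx l → Vtx l → Set
  Exchanges c c' a b a' b' =
    (u v : Vtx l) → (InΔ c' u v → InFlippedΔ c a b a' b' u v) × (InFlippedΔ c a b a' b' u v → InΔ c' u v)

  OtherDiagonal : (Fin (suc l) → Cell l) → Vtx l → Vtx l → Vtx l → Vtx l → Set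
  OtherDiagonal c a b a' b' = ∃[ x ] ∃[ y ]
    StrictlyBetween a x b × StrictlyBetween b y a ×
    EdgeOf c a x × EdgeOf c x b × EdgeOf c a y × EdgeOf c y b ×
    SameDiag a' b' x y

module _ {l : ℕ} (c : Fin (suc l) → Cell l) (i : Fin (suc l)) (c̃ : Cell l) where

  replace-self : replace c i c̃ i ≡ c̃
  replace-self with i ≟ i
  ... | yes _   = refl
  ... | no i≢i = ⊥-elim (i≢i refl)

  replace-other : ∀ {k} → k ≢ i → replace c i c̃ k ≡ c k
  replace-other {k} k≢i with k ≟ i
  ... | yes k≡i = ⊥-elim (k≢i k≡i)
  ... | no _    = refl

  replace-exchanges :
    (∀ {j k} → SameDiag (proj₁ (c j)) (proj₂ (c j)) (proj₁ (c k)) (proj₂ (c k)) → j ≡ k) →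
    Exchanges c (replace c i c̃) (proj₁ (c i)) (proj₂ (c i)) (proj₁ c̃) (proj₂ c̃)
  replace-exchanges diagonal-injective u v = to , from
    where
    DiagOf : Cell l → Set
    DiagOf (a , b) = SameDiag a b u v

    to : InΔ (replace c i c̃) u v → InFlippedΔ c (proj₁ (c i)) (proj₂ (c i)) (proj₁ c̃) (proj₂ c̃) u v
    to (k , d) with k ≟ i
    ... | yes _   = inj₂ (SameDiag-sym d)
    ... | no k≢i = inj₁ ((k , d) , λ d' → k≢i (diagonal-injective (SameDiag-trans d d')))

    from : InFlippedΔ c (proj₁ (c i)) (proj₂ (c i)) (proj₁ c̃) (proj₂ c̃) u v → InΔ (replace c i c̃) u v
    from (inj₂ d) = i , subst DiagOf (sym replace-self) (SameDiag-sym d)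
    from (inj₁ ((k , d) , d≢)) with k ≟ i
    ... | yes refl = ⊥-elim (d≢ (SameDiag-sym d))
    ... | no k≢i  = k , subst DiagOf (sym (replace-other k≢i)) d

module _ {l : ℕ} {c : Fin (suc l) → Cell l} where

  inc-otherDiagonal : ∀ {a b d e} → sub a b ≡ 2 + d → sub b a ≡ 2 + e →
    EdgeOf c (inc a) b → EdgeOf c a (inc b) → OtherDiagonal c a b (inc a) (inc b)
  inc-otherDiagonal {a} {b} ab ba edge₁ edge₂ =
    inc a , inc b , inc-strictlyBetween a b ba , inc-strictlyBetween b a ab ,
    inj₁ (inj₁ refl) , edge₁ , edge₂ , inj₁ (inj₂ refl) , inj₁ (refl , refl)

  dec-otherDiagonal : ∀ {a b d e} → sub a b ≡ 2 + d → sub b a ≡ 2 + e →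
    EdgeOf c a (dec b) → EdgeOf c (dec a) b → OtherDiagonal c a b (dec a) (dec b)
  dec-otherDiagonal {a} {b} ab ba edge₁ edge₂ =
    dec b , dec a , dec-strictlyBetween a b ba , dec-strictlyBetween b a ab ,
    edge₁ , inj₁ (inj₁ (sym (inc-dec b))) , inj₁ (inj₂ (sym (inc-dec a))) , edge₂ , inj₂ (refl , refl)

  InΔ-east-source : ∀ p k → East (c p) (c k) → InΔ c (dec (proj₁ (c k))) (proj₂ (c k))
  InΔ-east-source p k (q≡ , r≡) = p , inj₁ (trans (sym (dec-inc _)) (cong dec (sym q≡)) , sym r≡)

  InΔ-east-target : ∀ k s → East (c k) (c s) → InΔ c (inc (proj₁ (c k))) (proj₂ (c k))
  InΔ-east-target k s (q≡ , r≡) = s , inj₁ (q≡ , r≡)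

  InΔ-north-source : ∀ p k → North (c p) (c k) → InΔ c (proj₁ (c k)) (inc (proj₂ (c k)))
  InΔ-north-source p k (q≡ , r≡) = p , inj₁ (sym q≡ , trans (sym (inc-dec _)) (cong inc (sym r≡)))

  InΔ-north-target : ∀ k s → North (c k) (c s) → InΔ c (proj₁ (c k)) (dec (proj₂ (c k)))
  InΔ-north-target k s (q≡ , r≡) = s , inj₁ (q≡ , r≡)

module _ {l : ℕ} (w : Worm l) (i : Fin (suc l)) where

  private
    q r : Vtx l
    q = proj₁ (cell w i)
    r = proj₂ (cell w i)

    i≤l : toℕ i ≤ l
    i≤l = toℕ≤pred[n] i

    width : sub q r ≡ 2 + toℕ i
    width = worm-width w i

    coWidth : sub r q ≡ 2 + (l ∸ toℕ i)
    coWidth = sub-flip q r width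
      (cong (2 +_) (trans (+-suc (toℕ i) _) (cong suc (trans (+-suc (toℕ i) _) (cong suc (m+[n∸m]≡n i≤l))))))

    first-side : toℕ i ≡ 0 → q ≡ inc (inc r)
    first-side i≡0 = sub≡2⇒≡inc-inc q r (start w i i≡0)

    last-side : toℕ i ≡ l → r ≡ inc (inc q)
    last-side i≡l = sub≡2⇒≡inc-inc r q
      (trans coWidth (cong (2 +_) (trans (cong (l ∸_) i≡l) (n∸n≡0 l))))

  worm-otherDiagonal : ∀ {c̃} → OpAt w i c̃ → OtherDiagonal (cell w) q r (proj₁ c̃) (proj₂ c̃)
  worm-otherDiagonal (neBend p s _ _ north east) = inc-otherDiagonal width coWidth
    (inj₂ (InΔ-east-target i s east)) (inj₂ (InΔ-north-source p i north))
  worm-otherDiagonal (enBend p s _ _ east north) = dec-otherDiagonal width coWidth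
    (inj₂ (InΔ-north-target i s north)) (inj₂ (InΔ-east-source p i east))
  worm-otherDiagonal (firstE s i≡0 _ east) = inc-otherDiagonal width coWidth
    (inj₂ (InΔ-east-target i s east)) (inj₁ (inj₂ (first-side i≡0)))
  worm-otherDiagonal (firstN s i≡0 _ north) = dec-otherDiagonal width coWidth
    (inj₂ (InΔ-north-target i s north)) (inj₁ (inj₂ (trans (cong dec (first-side i≡0)) (dec-inc (inc r)))))
  worm-otherDiagonal (lastN p i≡l _ north) = inc-otherDiagonal width coWidth
    (inj₁ (inj₁ (last-side i≡l))) (inj₂ (InΔ-north-source p i north))
  worm-otherDiagonal (lastE p i≡l _ east) = dec-otherDiagonal width coWidth
    (inj₁ (inj₁ (trans (cong dec (last-side i≡l)) (dec-inc (inc q))))) (inj₂ (InΔ-east-source p i east))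

lemma5p4 : (l : ℕ) → 1 ≤ l → (w : Worm l) → (i : Fin (suc l)) → (c̃ : Cell l) →
    OpAt w i c̃ →
    IsFlip (cell w) (replace (cell w) i c̃)
      (proj₁ (cell w i)) (proj₂ (cell w i)) (proj₁ c̃) (proj₂ c̃)
lemma5p4 l _ w i c̃ op =
  worm-otherDiagonal w i op , replace-exchanges (cell w) i c̃ (worm-diagonal-injective w)
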